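{- Let $\Gamma$ be a set of bunches. Then $\Gamma$ is weakly invariant under depth substitutions if and only if $\Gamma$ is strongly invariant under depth substitutions.
   Context: Atoms $p_1,p_2,\dots$; formulas built by $\neg,\land,\lor,\to,\circ$; bunches built from formulas by comma $(X,Y)$ and semicolon $(X;Y)$. A depth substitution is a function $d:\mathbb{Z}\times\mathsf{At}\to$ formulas, written $d^n(p)$, extended to bunches by $d^n(\neg A)=\neg d^n(A)$, $d^n(A\land B)=d^n(A)\land d^n(B)$, $d^n(A\lor B)=d^n(A)\lor d^n(B)$, $d^n(A\to B)=d^{n+1}(A)\to d^{n+1}(B)$, $d^n(A\circ B)=d^{n-1}(A)\circ d^n(B)$, $d^n(X,Y)=d^n(X),d^n(Y)$, $d^n(X;Y)=d^{n-1}(X);d^n(Y)$. $\Gamma$ is weakly invariant under depth substitutions if for every depth substitution $d$, $X\in\Gamma$ implies $d^0(X)\in\Gamma$; it is strongly invariant if for every depth substitution $d$ and every $n\in\mathbb{Z}$, $X\in\Gamma$ implies $d^n(X)\in\Gamma$. -}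

module Defs where

open import Data.Nat using (ℕ)
open import Data.Integer using (ℤ; _+_; _-_; +_; 1ℤ)

Atom : Set
Atom = ℕ

data Formula : Set where
  atom : Atom → Formula
  ¬'_  : Formula → Formula
  _∧'_ : Formula → Formula → Formula
  _∨'_ : Formula → Formula → Formula
  _⇒'_ : Formula → Formula → Formula
  _∘'_ : Formula → Formula → Formula

data Bunch : Set where
  form : Formula → Bunch
  _,,_ : Bunch → Bunch → Bunch
  _⨾_ : Bunch → Bunch → Bunch

DepthSubst : Set
DepthSubst = ℤ → Atom → Formula

dF : DepthSubst → ℤ → Formula → Formula
dF d n (atom p)  = d n p
dF d n (¬' A)    = ¬' dF d n A
dF d n (A ∧' B)  = dF d n A ∧' dF d n B
dF d n (A ∨' B)  = dF d n A ∨' dF d n B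
dF d n (A ⇒' B)  = dF d (n + 1ℤ) A ⇒' dF d (n + 1ℤ) B
dF d n (A ∘' B)  = dF d (n - 1ℤ) A ∘' dF d n B

dB : DepthSubst → ℤ → Bunch → Bunch
dB d n (form A) = form (dF d n A)
dB d n (X ,, Y) = dB d n X ,, dB d n Y
dB d n (X ⨾ Y) = dB d (n - 1ℤ) X ⨾ dB d n Y

BunchSet : Set₁
BunchSet = Bunch → Set

WeaklyInvariant : BunchSet → Set
WeaklyInvariant Γ = ∀ (d : DepthSubst) (X : Bunch) → Γ X → Γ (dB d (+ 0) X)

StronglyInvariant : BunchSet → Set
StronglyInvariant Γ = ∀ (d : DepthSubst) (n : ℤ) (X : Bunch) → Γ X → Γ (dB d n X)

{-# OPTIONS --safe #-}
module Submission where

-- Proof idea: shifting a depth substitution, (shift n d)^m = d^(m + n), turns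
-- the depth-0 instance of one substitution into the depth-n instance of another,
-- d^n(X) = (shift n d)^0(X), since every clause of the extension only adds a
-- constant to the depth.

open import Defs
open import Function.Bundles using (_⇔_; mk⇔)
open import Data.Integer using (ℤ; _+_; _-_; +_; 1ℤ; -_)
open import Data.Integer.Properties using (+-identityˡ; +-commutativeSemigroup)
open import Algebra.Properties.CommutativeSemigroup +-commutativeSemigroup using (xy∙z≈xz∙y)
open import Relation.Binary.PropositionalEquality using (_≡_; refl; cong; cong₂; trans; subst)

shift : ℤ → DepthSubst → DepthSubst
shift n d m = d (m + n)

dF-shift : ∀ d n m A → dF (shift n d) m A ≡ dF d (m + n) A
dF-shift d n m (atom p)  = refl
dF-shift d n m (¬' A)    = cong ¬'_ (dF-shift d n m A)
dF-shift d n m (A ∧' B)  = cong₂ _∧'_ (dF-shift d n m A) (dF-shift d n m B)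
dF-shift d n m (A ∨' B)  = cong₂ _∨'_ (dF-shift d n m A) (dF-shift d n m B)
dF-shift d n m (A ⇒' B)  = cong₂ _⇒'_
  (trans (dF-shift d n (m + 1ℤ) A) (cong (λ k → dF d k A) (xy∙z≈xz∙y m 1ℤ n)))
  (trans (dF-shift d n (m + 1ℤ) B) (cong (λ k → dF d k B) (xy∙z≈xz∙y m 1ℤ n)))
dF-shift d n m (A ∘' B)  = cong₂ _∘'_
  (trans (dF-shift d n (m - 1ℤ) A) (cong (λ k → dF d k A) (xy∙z≈xz∙y m (- 1ℤ) n)))
  (dF-shift d n m B)

dB-shift : ∀ d n m X → dB (shift n d) m X ≡ dB d (m + n) X
dB-shift d n m (form A) = cong form (dF-shift d n m A)
dB-shift d n m (X ,, Y) = cong₂ _,,_ (dB-shift d n m X) (dB-shift d n m Y)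
dB-shift d n m (X ⨾ Y)  = cong₂ _⨾_
  (trans (dB-shift d n (m - 1ℤ) X) (cong (λ k → dB d k X) (xy∙z≈xz∙y m (- 1ℤ) n)))
  (dB-shift d n m Y)

dB-shift-at-0 : ∀ d n X → dB (shift n d) (+ 0) X ≡ dB d n X
dB-shift-at-0 d n X = trans (dB-shift d n (+ 0) X) (cong (λ k → dB d k X) (+-identityˡ n))

weak⇒strong : ∀ {Γ} → WeaklyInvariant Γ → StronglyInvariant Γ
weak⇒strong {Γ} weak d n X X∈Γ = subst Γ (dB-shift-at-0 d n X) (weak (shift n d) X X∈Γ)

strong⇒weak : ∀ {Γ} → StronglyInvariant Γ → WeaklyInvariant Γ
strong⇒weak strong d = strong d (+ 0)

corollary11 : (Γ : BunchSet) → WeaklyInvariant Γ ⇔ StronglyInvariant Γ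
corollary11 Γ = mk⇔ weak⇒strong strong⇒weak
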